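{- Let $2\le k\le n$ and $1\le m\le\binom nk$. Let $\mathcal{A}=\{A_1,\dots,A_m\}$ be the family of the first $m$ $k$-subsets of $[n]$ in squashed order, listed in squashed order, and let $\mathcal{B}=\binom{[n]}{k-1}\setminus\Delta\mathcal{A}$, so that $\mathcal{F}=\mathcal{A}\cup\mathcal{B}$ is a full squashed flat antichain. Write $A_m=\{x_1,x_2,\dots,x_k\}$ with $x_1<x_2<\dots<x_k$. Then $\mathcal{F}$ is a maximal squashed flat antichain if and only if $x_2=x_1+1$.
   Context: $[n]=\{1,\dots,n\}$, $\binom{[n]}{i}$ is the family of $i$-subsets of $[n]$. Squashed (colexicographic) order: for distinct $F,G\subseteq[n]$, $F<_S G$ iff $\max\bigl((F\cup G)\setminus(F\cap G)\bigr)\in G$. For $\mathcal{G}\subseteq\binom{[n]}{i}$, the shadow is $\Delta\mathcal{G}=\{H\in\binom{[n]}{i-1}: H\subset G \text{ for some } G\in\mathcal{G}\}$ and the shade is $\nabla\mathcal{G}=\{H\in\binom{[n]}{i+1}: H\supset G\text{ for some }G\in\mathcal{G}\}$. A full squashed flat antichain (FSFA) is a family $\mathcal{A}\cup\mathcal{B}$ where, for some $1\le k\le n$ and $0\le m\le\binom nk$, $\mathcal{A}$ is the set of the first $m$ elements of $\binom{[n]}{k}$ in squashed order and $\mathcal{B}=\binom{[n]}{k-1}\setminus\Delta\mathcal{A}$. It is a maximal squashed flat antichain (MSFA) if additionally $\mathcal{A}=\binom{[n]}{k}\setminus\nabla\mathcal{B}$. -}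

module Defs where

open import Data.Nat using (ℕ; suc; _≤_; _∸_)
open import Data.Fin using (Fin; toℕ; fromℕ)
import Data.Fin as F
open import Data.Fin.Subset using (Subset; _∈_; _∉_; _⊂_; ∣_∣)
open import Data.Product using (Σ; ∃; _×_)
open import Data.Sum using (_⊎_)
open import Relation.Nullary using (¬_)
open import Relation.Binary.PropositionalEquality using (_≡_)
open import Function.Bundles using (_⇔_)

-- The ground set [n] = {1,…,n} is modelled by Fin n, element i ↦ toℕ i + 1.
-- A family of subsets of [n] is a predicate on Subset n.
Family : ℕ → Set₁
Family n = Subset n → Set

-- Squashed (colex) order: F <S G iff max of the symmetric difference lies in G.
-- "x is the maximum of F △ G and x ∈ G":
_<S_ : ∀ {n} → Subset n → Subset n → Set
_<S_ {n} F G = ∃ λ (x : Fin n) → x ∈ G × x ∉ F ×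
  (∀ (y : Fin n) → x F.< y → (y ∈ F → y ∈ G) × (y ∈ G → y ∈ F))

Δ : ∀ {n} → ℕ → Family n → Family n
Δ i 𝒢 H = (∣ H ∣ ≡ i ∸ 1) × ∃ λ G → 𝒢 G × H ⊂ G

∇ : ∀ {n} → ℕ → Family n → Family n
∇ i 𝒢 H = (∣ H ∣ ≡ suc i) × ∃ λ G → 𝒢 G × G ⊂ H

IsSquashedInitial : ∀ {n m} → ℕ → (Fin m → Subset n) → Set
IsSquashedInitial {n} {m} k A =
  (∀ j → ∣ A j ∣ ≡ k) ×
  (∀ i j → i F.< j → A i <S A j) ×
  (∀ (G : Subset n) → ∣ G ∣ ≡ k → ∀ j → G <S A j → ∃ λ i → A i ≡ G)

famOf : ∀ {n m} → (Fin m → Subset n) → Family n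
famOf A S = ∃ λ j → A j ≡ S

complShadow : ∀ {n} → ℕ → Family n → Family n
complShadow k 𝒜 H = (∣ H ∣ ≡ k ∸ 1) × ¬ Δ k 𝒜 H

-- 𝒜 ∪ ℬ is a maximal squashed flat antichain: 𝒜 = binom([n],k) \ ∇ℬ
IsMSFA : ∀ {n} → ℕ → Family n → Set
IsMSFA {n} k 𝒜 = ∀ (S : Subset n) →
  𝒜 S ⇔ ((∣ S ∣ ≡ k) × ¬ ∇ (k ∸ 1) (complShadow k 𝒜) S)

lastIx : ∀ {m} → 1 ≤ m → Fin m
lastIx {suc m} _ = fromℕ m

SecondIsSucc : ∀ {n} → Subset n → Set
SecondIsSucc {n} A = ∃ λ (x₁ : Fin n) → ∃ λ (x₂ : Fin n) →
  x₁ ∈ A × x₂ ∈ A × x₁ F.< x₂ ×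
  (∀ y → y ∈ A → x₁ F.≤ y) ×
  (∀ y → y ∈ A → ¬ (y ≡ x₁) → x₂ F.≤ y) ×
  (toℕ x₂ ≡ suc (toℕ x₁))

-- Write L = A_m. Then 𝒜 is the set of k-sets S ≤ L in squashed order, so 𝒜 ∪ ℬ is
-- maximal iff every k-set S with L <S S has a (k-1)-subset outside Δ𝒜.
-- Suppose x₂ = x₁ + 1 and let d be the largest element of S △ L, so d ∈ S ∖ L.
-- If min S < d, every k-superset of S - min S contains d and the elements of L above d,
-- so it is squashed-above L and S - min S ∉ Δ𝒜. If min S = d, the k - 1 elements of S
-- above d are those of L above d, so L has exactly one element below d: x₁ < d < x₂.
-- Conversely, if x₁ < c < x₂, then S = L - x₁ + c is squashed-above L, yet every
-- (k-1)-subset S - e lies in L (when e = c) or in L - e + c <S L, so S ∉ ∇ℬ.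
module Submission where

open import Defs
open import Data.Nat using (ℕ; zero; suc; _≤_; _∸_; s≤s; z≤n)
import Data.Nat as ℕ
import Data.Nat.Properties as ℕ
open import Data.Nat.Combinatorics using (_C_)
open import Data.Fin using (Fin; zero; suc; toℕ; fromℕ; fromℕ<)
import Data.Fin as F
import Data.Fin.Properties as F
open import Data.Fin.Subset using (Subset; inside; outside; _∈_; _∉_; _⊆_; _⊂_; ∣_∣; Nonempty)
open import Data.Fin.Subset.Properties
  using (_∈?_; nonempty?; Empty-unique; ∣⊥∣≡0; ⊆-antisym; p⊂q⇒∣p∣<∣q∣)
open import Data.Vec.Base using (_∷_; here; there; _[_]≔_)
open import Data.Vec.Properties
  using ([]=-injective; []=⇒lookup; lookup⇒[]=; lookup∘update′; []≔-updates; []≔-minimal)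
open import Data.Product using (∃; ∃₂; _×_; _,_; proj₁; proj₂; swap)
open import Data.Sum using (_⊎_; inj₁; inj₂)
open import Data.Empty using (⊥-elim)
open import Function using (_∘_)
open import Function.Bundles using (_⇔_; mk⇔; Equivalence)
open import Relation.Binary.Definitions using (tri<; tri≈; tri>)
open import Relation.Binary.PropositionalEquality using (_≡_; _≢_; refl; sym; trans; cong; subst)
open import Relation.Nullary using (¬_; yes; no; ¬?; _×-dec_; _⊎-dec_; decidable-stable)
open import Relation.Unary using (Decidable)

private variable n : ℕ

least : ∀ {P : Fin n → Set} → Decidable P →
        (∀ x → ¬ P x) ⊎ ∃ λ x → P x × (∀ y → y F.< x → ¬ P y)
least {zero}  P? = inj₁ λ ()
least {suc n} P? with P? zero
... | yes p₀ = inj₂ (zero , p₀ , λ _ ())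
... | no ¬p₀ with least (P? ∘ suc)
...   | inj₁ none             = inj₁ λ { zero → ¬p₀ ; (suc y) → none y }
...   | inj₂ (x , px , below) =
  inj₂ (suc x , px , λ { zero _ → ¬p₀ ; (suc y) (s≤s y<x) → below y y<x })

greatest : ∀ {P : Fin n → Set} → Decidable P →
           (∀ x → ¬ P x) ⊎ ∃ λ x → P x × (∀ y → x F.< y → ¬ P y)
greatest {zero}  P? = inj₁ λ ()
greatest {suc n} P? with greatest (P? ∘ suc)
... | inj₂ (x , px , above) =
  inj₂ (suc x , px , λ { zero () ; (suc y) (s≤s x<y) → above y x<y })
... | inj₁ none with P? zero
...   | yes p₀ = inj₂ (zero , p₀ , λ { zero () ; (suc y) _ → none y })
...   | no ¬p₀ = inj₁ λ { zero → ¬p₀ ; (suc y) → none y }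

x∉p[x]≔outside : ∀ (p : Subset n) x → x ∉ p [ x ]≔ outside
x∉p[x]≔outside p x x∈ with () ← []=-injective x∈ ([]≔-updates p x)

∈-[]≔⁻ : ∀ (p : Subset n) {x y} b → y ≢ x → y ∈ p [ x ]≔ b → y ∈ p
∈-[]≔⁻ p {y = y} b y≢x y∈ =
  lookup⇒[]= y p (trans (sym (lookup∘update′ y≢x p b)) ([]=⇒lookup y∈))

∣p[x]≔inside∣ : ∀ (p : Subset n) {x} → x ∉ p → ∣ p [ x ]≔ inside ∣ ≡ suc ∣ p ∣
∣p[x]≔inside∣ (outside ∷ p) {zero}  x∉ = refl
∣p[x]≔inside∣ (inside  ∷ p) {zero}  x∉ = ⊥-elim (x∉ here)
∣p[x]≔inside∣ (outside ∷ p) {suc x} x∉ = ∣p[x]≔inside∣ p (x∉ ∘ there)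
∣p[x]≔inside∣ (inside  ∷ p) {suc x} x∉ = cong suc (∣p[x]≔inside∣ p (x∉ ∘ there))

∣p[x]≔outside∣ : ∀ (p : Subset n) {x} → x ∈ p → suc ∣ p [ x ]≔ outside ∣ ≡ ∣ p ∣
∣p[x]≔outside∣ (inside  ∷ p) here       = refl
∣p[x]≔outside∣ (outside ∷ p) (there x∈) = ∣p[x]≔outside∣ p x∈
∣p[x]≔outside∣ (inside  ∷ p) (there x∈) = cong suc (∣p[x]≔outside∣ p x∈)

exchange : Subset n → Fin n → Fin n → Subset n
exchange p x y = p [ x ]≔ outside [ y ]≔ inside

module _ (p : Subset n) {x y : Fin n} where

  y∈exchange : y ∈ exchange p x y
  y∈exchange = []≔-updates _ y

  x∉exchange : x ≢ y → x ∉ exchange p x y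
  x∉exchange x≢y = x∉p[x]≔outside p x ∘ ∈-[]≔⁻ _ inside x≢y

  ∈-exchange⁻ : ∀ {z} → z ≢ y → z ∈ exchange p x y → z ∈ p
  ∈-exchange⁻ {z} z≢y z∈ = ∈-[]≔⁻ p outside z≢x z∈′
    where
    z∈′ : z ∈ p [ x ]≔ outside
    z∈′ = ∈-[]≔⁻ _ inside z≢y z∈
    z≢x : z ≢ x
    z≢x refl = x∉p[x]≔outside p z z∈′

  ∈-exchange-untouched : ∀ {z} → z ≢ x → z ≢ y →
                         (z ∈ p → z ∈ exchange p x y) × (z ∈ exchange p x y → z ∈ p)
  ∈-exchange-untouched {z} z≢x z≢y =
    []≔-minimal _ z y z≢y ∘ []≔-minimal p z x z≢x , ∈-exchange⁻ z≢y

  ∣exchange∣ : x ∈ p → y ∉ p → ∣ exchange p x y ∣ ≡ ∣ p ∣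
  ∣exchange∣ x∈p y∉p = trans (∣p[x]≔inside∣ _ y∉p′) (∣p[x]≔outside∣ p x∈p)
    where
    y∉p′ : y ∉ p [ x ]≔ outside
    y∉p′ with y F.≟ x
    ... | yes refl = x∉p[x]≔outside p x
    ... | no y≢x   = y∉p ∘ ∈-[]≔⁻ p outside y≢x

nonempty : ∀ {p : Subset n} → 0 ℕ.< ∣ p ∣ → Nonempty p
nonempty {n} {p} 0<∣p∣ with nonempty? p
... | yes ne    = ne
... | no empty  =
  ⊥-elim (ℕ.<-irrefl (sym (trans (cong ∣_∣ (Empty-unique empty)) (∣⊥∣≡0 n))) 0<∣p∣)

minimum : ∀ {p : Subset n} → Nonempty p → ∃ λ x → x ∈ p × (∀ y → y ∈ p → x F.≤ y)
minimum {p = p} (z , z∈p) with least (_∈? p)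
... | inj₁ none             = ⊥-elim (none z z∈p)
... | inj₂ (x , x∈p , below) = x , x∈p , λ y y∈p → ℕ.≮⇒≥ λ y<x → below y y<x y∈p

twoSmallest : ∀ (p : Subset n) → 2 ≤ ∣ p ∣ → ∃₂ λ x₁ x₂ →
  x₁ ∈ p × x₂ ∈ p × x₁ F.< x₂ ×
  (∀ y → y ∈ p → x₁ F.≤ y) × (∀ y → y ∈ p → y ≢ x₁ → x₂ F.≤ y)
twoSmallest p 2≤∣p∣ with minimum (nonempty (ℕ.≤-trans (s≤s z≤n) 2≤∣p∣))
... | x₁ , x₁∈p , x₁-min with minimum (nonempty 0<∣p′∣)
  where
  0<∣p′∣ : 0 ℕ.< ∣ p [ x₁ ]≔ outside ∣
  0<∣p′∣ = ℕ.≤-pred (subst (2 ≤_) (sym (∣p[x]≔outside∣ p x₁∈p)) 2≤∣p∣)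
... | x₂ , x₂∈p′ , x₂-min =
  x₁ , x₂ , x₁∈p , x₂∈p , F.≤∧≢⇒< (x₁-min x₂ x₂∈p) (x₂≢x₁ ∘ sym) , x₁-min ,
  λ y y∈p y≢x₁ → x₂-min y ([]≔-minimal p y x₁ y≢x₁ y∈p)
  where
  x₂≢x₁ : x₂ ≢ x₁
  x₂≢x₁ refl = x∉p[x]≔outside p x₁ x₂∈p′
  x₂∈p : x₂ ∈ p
  x₂∈p = ∈-[]≔⁻ p outside x₂≢x₁ x₂∈p′

strictlyBetween : ∀ {x z : Fin n} → x F.< z → toℕ z ≢ suc (toℕ x) →
                  ∃ λ y → x F.< y × y F.< z
strictlyBetween {n} {x} {z} x<z gap = y , x<y , F.≤∧≢⇒< y≤z y≢z
  where
  1+x<n : suc (toℕ x) ℕ.< n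
  1+x<n = ℕ.≤-<-trans x<z (F.toℕ<n z)
  y : Fin n
  y = fromℕ< 1+x<n
  toℕy : toℕ y ≡ suc (toℕ x)
  toℕy = F.toℕ-fromℕ< 1+x<n
  x<y : x F.< y
  x<y = ℕ.≤-reflexive (sym toℕy)
  y≤z : y F.≤ z
  y≤z = subst (ℕ._≤ toℕ z) (sym toℕy) x<z
  y≢z : y ≢ z
  y≢z y≡z = gap (trans (cong toℕ (sym y≡z)) toℕy)

<S-irrefl : ∀ {p : Subset n} → ¬ p <S p
<S-irrefl (x , x∈p , x∉p , _) = x∉p x∈p

<S-asym : ∀ {p q : Subset n} → p <S q → ¬ q <S p
<S-asym (x , x∈q , x∉p , agree-x) (z , z∈p , z∉q , agree-z) with F.<-cmp x z
... | tri< x<z _ _ = z∉q (proj₁ (agree-x z x<z) z∈p)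
... | tri≈ _ refl _ = x∉p z∈p
... | tri> _ _ z<x = x∉p (proj₁ (agree-z x z<x) x∈q)

SymDiff : Subset n → Subset n → Fin n → Set
SymDiff p q x = (x ∈ q × x ∉ p) ⊎ (x ∈ p × x ∉ q)

symDiff? : ∀ (p q : Subset n) → Decidable (SymDiff p q)
symDiff? p q x = (x ∈? q ×-dec ¬? (x ∈? p)) ⊎-dec (x ∈? p ×-dec ¬? (x ∈? q))

∉SymDiff : ∀ {p q : Subset n} {x} → ¬ SymDiff p q x → (x ∈ p → x ∈ q) × (x ∈ q → x ∈ p)
∉SymDiff {p = p} {q} {x} x∉ =
  (λ x∈p → decidable-stable (x ∈? q) λ x∉q → x∉ (inj₂ (x∈p , x∉q))) ,
  (λ x∈q → decidable-stable (x ∈? p) λ x∉p → x∉ (inj₁ (x∈q , x∉p)))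

<S-trichotomy : ∀ (p q : Subset n) → p ≡ q ⊎ p <S q ⊎ q <S p
<S-trichotomy p q with greatest (symDiff? p q)
... | inj₁ none =
  inj₁ (⊆-antisym (λ {x} → proj₁ (∉SymDiff (none x))) (λ {x} → proj₂ (∉SymDiff (none x))))
... | inj₂ (x , inj₁ (x∈q , x∉p) , above) =
  inj₂ (inj₁ (x , x∈q , x∉p , λ y x<y → ∉SymDiff (above y x<y)))
... | inj₂ (x , inj₂ (x∈p , x∉q) , above) =
  inj₂ (inj₂ (x , x∈p , x∉q , λ y x<y → swap (∉SymDiff (above y x<y))))

<S-dominated : ∀ {p q : Subset n} {y} → y ∈ q → y ∉ p →
               (∀ z → y F.< z → z ∈ p → z ∈ q) → p <S q
<S-dominated {p = p} {q} {y} y∈q y∉p dominated with <S-trichotomy p q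
... | inj₁ refl         = ⊥-elim (y∉p y∈q)
... | inj₂ (inj₁ p<q)   = p<q
... | inj₂ (inj₂ (t , t∈p , t∉q , agree)) with F.<-cmp y t
...   | tri< y<t _ _  = ⊥-elim (t∉q (dominated t y<t t∈p))
...   | tri≈ _ refl _ = ⊥-elim (y∉p t∈p)
...   | tri> _ _ t<y  = ⊥-elim (y∉p (proj₁ (agree y t<y) y∈q))

IsMSFA⁺ : ∀ {k} {𝒜 : Family n} → (∀ {S} → 𝒜 S → ∣ S ∣ ≡ k) →
          (∀ S → ∣ S ∣ ≡ k → ¬ ∇ (k ∸ 1) (complShadow k 𝒜) S → 𝒜 S) → IsMSFA k 𝒜
IsMSFA⁺ uniform closed S = mk⇔
  (λ S∈𝒜 → uniform S∈𝒜 , λ (_ , H , (∣H∣ , H∉Δ𝒜) , H⊂S) → H∉Δ𝒜 (∣H∣ , S , S∈𝒜 , H⊂S))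
  (λ (∣S∣ , uncovered) → closed S ∣S∣ uncovered)

module SquashedInitialSegment {n m k : ℕ}
         (A : Fin (suc m) → Subset n) (initial : IsSquashedInitial k A) where

  𝒜 : Family n
  𝒜 = famOf A

  ℬ : Family n
  ℬ = complShadow k 𝒜

  L : Subset n
  L = A (fromℕ m)

  ∈𝒜⇒∣∣≡k : ∀ {S} → 𝒜 S → ∣ S ∣ ≡ k
  ∈𝒜⇒∣∣≡k (j , refl) = proj₁ initial j

  L∈𝒜 : 𝒜 L
  L∈𝒜 = fromℕ m , refl

  <L⇒∈𝒜 : ∀ {S} → ∣ S ∣ ≡ k → S <S L → 𝒜 S
  <L⇒∈𝒜 {S} ∣S∣ S<L = proj₂ (proj₂ initial) S ∣S∣ (fromℕ m) S<L

  L<⇒∉𝒜 : ∀ {S} → L <S S → ¬ 𝒜 S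
  L<⇒∉𝒜 L<S (j , refl) with j F.≟ fromℕ m
  ... | yes refl = <S-irrefl L<S
  ... | no j≢m   =
    <S-asym (proj₁ (proj₂ initial) j (fromℕ m) (F.≤∧≢⇒< (F.≤fromℕ j) j≢m)) L<S

  module _ {x c} (x∈L : x ∈ L) (c∉L : c ∉ L) (x<c : x F.< c)
           (c<rest : ∀ y → y ∈ L → y ≢ x → c F.< y) where

    private
      S : Subset n
      S = exchange L x c

      x∉S : x ∉ S
      x∉S = x∉exchange L (F.<⇒≢ x<c)

    L<exchange : L <S exchange L x c
    L<exchange = c , y∈exchange L , c∉L , λ y c<y →
      ∈-exchange-untouched L (F.<⇒≢ (ℕ.<-trans x<c c<y) ∘ sym) (F.<⇒≢ c<y ∘ sym)

    exchange∉∇ℬ : ¬ ∇ (k ∸ 1) ℬ (exchange L x c)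
    exchange∉∇ℬ (_ , H , (∣H∣ , H∉Δ𝒜) , H⊆S , e , e∈S , e∉H) with e F.≟ c
    ... | yes refl = H∉Δ𝒜 (∣H∣ , L , L∈𝒜 , H⊆L , x , x∈L , x∉S ∘ H⊆S)
      where
      H⊆L : H ⊆ L
      H⊆L {h} h∈H = ∈-exchange⁻ L (λ { refl → e∉H h∈H }) (H⊆S h∈H)
    ... | no e≢c = H∉Δ𝒜 (∣H∣ , G , G∈𝒜 , H⊆G , x , y∈exchange S , x∉S ∘ H⊆S)
      where
      G : Subset n
      G = exchange S e x
      e∈L : e ∈ L
      e∈L = ∈-exchange⁻ L e≢c e∈S
      e≢x : e ≢ x
      e≢x refl = x∉S e∈S
      c<e : c F.< e
      c<e = c<rest e e∈L e≢x
      G<L : G <S L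
      G<L = e , e∈L , x∉exchange S e≢x , λ y e<y →
        let y≢e = F.<⇒≢ e<y ∘ sym
            y≢c = F.<⇒≢ (ℕ.<-trans c<e e<y) ∘ sym
            y≢x = F.<⇒≢ (ℕ.<-trans (ℕ.<-trans x<c c<e) e<y) ∘ sym
            (L⇒S , S⇒L) = ∈-exchange-untouched L y≢x y≢c
            (S⇒G , G⇒S) = ∈-exchange-untouched S y≢e y≢x
        in S⇒L ∘ G⇒S , S⇒G ∘ L⇒S
      G∈𝒜 : 𝒜 G
      G∈𝒜 = <L⇒∈𝒜 ∣G∣ G<L
        where
        ∣G∣ : ∣ G ∣ ≡ k
        ∣G∣ = trans (∣exchange∣ S e∈S x∉S) (trans (∣exchange∣ L x∈L c∉L) (∈𝒜⇒∣∣≡k L∈𝒜))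
      H⊆G : H ⊆ G
      H⊆G {h} h∈H = proj₁ (∈-exchange-untouched S (λ { refl → e∉H h∈H }) h≢x) (H⊆S h∈H)
        where
        h≢x : h ≢ x
        h≢x refl = x∉S (H⊆S h∈H)

  msfa⇒secondIsSucc : 2 ≤ k → IsMSFA k 𝒜 → SecondIsSucc L
  msfa⇒secondIsSucc 2≤k msfa with twoSmallest L (subst (2 ≤_) (sym (∈𝒜⇒∣∣≡k L∈𝒜)) 2≤k)
  ... | x₁ , x₂ , x₁∈L , x₂∈L , x₁<x₂ , x₁-min , x₂-min =
    x₁ , x₂ , x₁∈L , x₂∈L , x₁<x₂ , x₁-min , x₂-min , consecutive
    where
    consecutive : toℕ x₂ ≡ suc (toℕ x₁)
    consecutive with toℕ x₂ ℕ.≟ suc (toℕ x₁)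
    ... | yes x₂≡1+x₁ = x₂≡1+x₁
    ... | no gap with strictlyBetween x₁<x₂ gap
    ...   | c , x₁<c , c<x₂ = ⊥-elim (L<⇒∉𝒜 (L<exchange x₁∈L c∉L x₁<c c<rest) S∈𝒜)
      where
      c<rest : ∀ y → y ∈ L → y ≢ x₁ → c F.< y
      c<rest y y∈L y≢x₁ = ℕ.<-≤-trans c<x₂ (x₂-min y y∈L y≢x₁)
      c∉L : c ∉ L
      c∉L c∈L = ℕ.<-irrefl refl (c<rest c c∈L (F.<⇒≢ x₁<c ∘ sym))
      S∈𝒜 : 𝒜 (exchange L x₁ c)
      S∈𝒜 = Equivalence.from (msfa _)
        ( trans (∣exchange∣ L x₁∈L c∉L) (∈𝒜⇒∣∣≡k L∈𝒜)
        , exchange∉∇ℬ x₁∈L c∉L x₁<c c<rest )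

  module _ {S d} (∣S∣ : ∣ S ∣ ≡ k) (d∈S : d ∈ S) (d∉L : d ∉ L)
           (agree : ∀ y → d F.< y → (y ∈ L → y ∈ S) × (y ∈ S → y ∈ L)) where

    covered-by-removing : ∀ {s} → s ∈ S → s F.< d → ∇ (k ∸ 1) ℬ S
    covered-by-removing {s} s∈S s<d =
      trans (sym (∣p[x]≔outside∣ S s∈S)) (cong suc ∣H∣) ,
      H , (∣H∣ , H∉Δ𝒜) , H⊆S , s , s∈S , s∉H
      where
      H : Subset n
      H = S [ s ]≔ outside
      1+∣H∣≡k : suc ∣ H ∣ ≡ k
      1+∣H∣≡k = trans (∣p[x]≔outside∣ S s∈S) ∣S∣
      ∣H∣ : ∣ H ∣ ≡ k ∸ 1
      ∣H∣ = cong (_∸ 1) 1+∣H∣≡k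
      s∉H : s ∉ H
      s∉H = x∉p[x]≔outside S s
      H⊆S : H ⊆ S
      H⊆S {h} h∈H = ∈-[]≔⁻ S outside (λ { refl → s∉H h∈H }) h∈H
      H∉Δ𝒜 : ¬ Δ k 𝒜 H
      H∉Δ𝒜 (_ , G , G∈𝒜 , H⊆G , _) = L<⇒∉𝒜 (<S-dominated (H⊆G d∈H) d∉L dominated) G∈𝒜
        where
        d∈H : d ∈ H
        d∈H = []≔-minimal S d s (F.<⇒≢ s<d ∘ sym) d∈S
        dominated : ∀ z → d F.< z → z ∈ L → z ∈ G
        dominated z d<z z∈L =
          H⊆G ([]≔-minimal S z s (F.<⇒≢ (ℕ.<-trans s<d d<z) ∘ sym) (proj₁ (agree z d<z) z∈L))

    module _ (d-min : ∀ y → y ∈ S → d F.≤ y) where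

      min-below : ∀ {x} → x ∈ L → (∀ y → y ∈ L → x F.≤ y) → x F.< d
      min-below {x} x∈L x-min with F.<-cmp x d
      ... | tri< x<d _ _ = x<d
      ... | tri≈ _ refl _ = ⊥-elim (d∉L x∈L)
      ... | tri> _ _ d<x =
        ⊥-elim (ℕ.<-irrefl (trans (∈𝒜⇒∣∣≡k L∈𝒜) (sym ∣S∣)) (p⊂q⇒∣p∣<∣q∣ L⊂S))
        where
        L⊂S : L ⊂ S
        L⊂S = (λ {y} y∈L → proj₁ (agree y (ℕ.<-≤-trans d<x (x-min y y∈L))) y∈L) ,
              d , d∈S , d∉L

      unique-below : ∀ {y y′} → y ∈ L → y′ ∈ L → y F.< d → y′ F.< d → y ≡ y′
      unique-below {y} {y′} y∈L y′∈L y<d y′<d with y F.≟ y′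
      ... | yes y≡y′ = y≡y′
      ... | no y≢y′ = ⊥-elim (ℕ.<-irrefl ∣P∣≡∣L∣ (p⊂q⇒∣p∣<∣q∣ P⊂L))
        where
        P : Subset n
        P = exchange S d y
        outside-S : ∀ {z} → z F.< d → z ∉ S
        outside-S z<d z∈S = ℕ.<⇒≱ z<d (d-min _ z∈S)
        ∣P∣≡∣L∣ : ∣ P ∣ ≡ ∣ L ∣
        ∣P∣≡∣L∣ = trans (∣exchange∣ S d∈S (outside-S y<d)) (trans ∣S∣ (sym (∈𝒜⇒∣∣≡k L∈𝒜)))
        P⊆L : P ⊆ L
        P⊆L {z} z∈P with z F.≟ y
        ... | yes refl = y∈L
        ... | no z≢y = proj₂ (agree z d<z) z∈S
          where
          z∈S : z ∈ S
          z∈S = ∈-exchange⁻ S z≢y z∈P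
          d<z : d F.< z
          d<z = F.≤∧≢⇒< (d-min z z∈S) λ { refl → x∉exchange S (F.<⇒≢ y<d ∘ sym) z∈P }
        P⊂L : P ⊂ L
        P⊂L = P⊆L , y′ , y′∈L , outside-S y′<d ∘ ∈-exchange⁻ S (y≢y′ ∘ sym)

      straddle : ∀ {x₁ x₂} → x₁ ∈ L → x₂ ∈ L → x₁ F.< x₂ → (∀ y → y ∈ L → x₁ F.≤ y) →
                 x₁ F.< d × d F.< x₂
      straddle {x₁} {x₂} x₁∈L x₂∈L x₁<x₂ x₁-min = x₁<d , d<x₂
        where
        x₁<d : x₁ F.< d
        x₁<d = min-below x₁∈L x₁-min
        d<x₂ : d F.< x₂
        d<x₂ with F.<-cmp x₂ d
        ... | tri< x₂<d _ _ = ⊥-elim (F.<⇒≢ x₁<x₂ (unique-below x₁∈L x₂∈L x₁<d x₂<d))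
        ... | tri≈ _ refl _ = ⊥-elim (d∉L x₂∈L)
        ... | tri> _ _ d<x₂ = d<x₂

  L<⇒covered : SecondIsSucc L → ∀ {S} → ∣ S ∣ ≡ k → L <S S → ∇ (k ∸ 1) ℬ S
  L<⇒covered (x₁ , x₂ , x₁∈L , x₂∈L , x₁<x₂ , x₁-min , _ , consecutive)
             {S} ∣S∣ (d , d∈S , d∉L , agree) with minimum (d , d∈S)
  ... | s , s∈S , s-min with F.<-cmp s d
  ...   | tri< s<d _ _ = covered-by-removing ∣S∣ d∈S d∉L agree s∈S s<d
  ...   | tri> _ _ d<s = ⊥-elim (ℕ.<⇒≱ d<s (s-min d d∈S))
  ...   | tri≈ _ refl _ =
    let x₁<d , d<x₂ = straddle ∣S∣ d∈S d∉L agree s-min x₁∈L x₂∈L x₁<x₂ x₁-min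
    in ⊥-elim (ℕ.<⇒≱ d<x₂ (subst (ℕ._≤ toℕ d) (sym consecutive) x₁<d))

  secondIsSucc⇒msfa : SecondIsSucc L → IsMSFA k 𝒜
  secondIsSucc⇒msfa consecutive = IsMSFA⁺ ∈𝒜⇒∣∣≡k closed
    where
    closed : ∀ S → ∣ S ∣ ≡ k → ¬ ∇ (k ∸ 1) ℬ S → 𝒜 S
    closed S ∣S∣ uncovered with <S-trichotomy S L
    ... | inj₁ refl = L∈𝒜
    ... | inj₂ (inj₁ S<L) = <L⇒∈𝒜 ∣S∣ S<L
    ... | inj₂ (inj₂ L<S) = ⊥-elim (uncovered (L<⇒covered consecutive ∣S∣ L<S))

lemma5 : (n k m : ℕ) → 2 ≤ k → k ≤ n → (1≤m : 1 ≤ m) → m ≤ n C k →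
    (A : Fin m → Subset n) → IsSquashedInitial k A →
    IsMSFA k (famOf A) ⇔ SecondIsSucc (A (lastIx 1≤m))
lemma5 n k (suc m) 2≤k _ _ _ A initial = mk⇔ (msfa⇒secondIsSucc 2≤k) secondIsSucc⇒msfa
  where open SquashedInitialSegment A initial
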